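{- Let $(S,E,M)$ be any Stirling-Euler-Mahonian triple of permutation statistics, and for integers $n\ge0$, $k$, define $$\left\langle {n \atop k}\right\rangle_{q,y}=\sum_{\sigma\in\mathfrak{S}_n,\ E(\sigma)=k-1}[y]_q^{S(\sigma)}\,q^{(n-S(\sigma))(y-1)+M(\sigma)}.$$ Then for any positive integers $n,k$, $$\left\langle {n \atop k}\right\rangle_{q,y}=[y+k-1]_q\left\langle {n-1 \atop k}\right\rangle_{q,y}+q^{y+k-2}[n-k+1]_q\left\langle {n-1 \atop k-1}\right\rangle_{q,y}.$$
   Context: $\mathfrak{S}_n$ is the set of permutations of $\{1,\dots,n\}$, written as words $\sigma=\sigma_1\cdots\sigma_n$; $\mathfrak{S}_0$ consists of the empty permutation, on which all statistics take the value $0$, and empty sums are $0$. A descent is an index $j\in\{1,\dots,n-1\}$ with $\sigma_j>\sigma_{j+1}$; $\mathrm{des}(\sigma)$ is the number of descents and $\mathrm{maj}(\sigma)$ their sum. A value $\sigma_j$ is a right-to-left minimum if $\sigma_j<\sigma_k$ for all $k>j$; $\mathrm{rlmin}(\sigma)$ is their number. A triple of statistics $(S,E,M)$ is Stirling-Euler-Mahonian if for every $n$, $\sum_{\sigma\in\mathfrak{S}_n}y^{S(\sigma)}x^{E(\sigma)}q^{M(\sigma)}=\sum_{\sigma\in\mathfrak{S}_n}y^{\mathrm{rlmin}(\sigma)}x^{\mathrm{des}(\sigma)}q^{\mathrm{maj}(\sigma)}$. For a real number $y$, $[y]_q=\frac{1-q^y}{1-q}$ (for integer $m\ge1$, $[m]_q=1+q+\cdots+q^{m-1}$);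 $y$ is a real parameter and the identity is an identity of functions of $q$ ($q>0$, $q\neq1$). -}

module Defs where

open import Data.Bool using (Bool; true; false; _∧_; if_then_else_)
open import Data.Nat using (ℕ; zero; suc; _∸_; _<ᵇ_; _≡ᵇ_) renaming (_+_ to _+ℕ_)
open import Data.Nat.ListAction using (sum)
open import Data.Fin using (Fin; toℕ)
open import Data.Fin.Base using ()
open import Data.List using (List; []; _∷_; map; concatMap; filterᵇ; length; allFin)
open import Data.Vec using (Vec; []; _∷_; toList)
open import Data.Integer using (ℤ; +_; -[1+_]; _⊖_)
open import Algebra.Bundles using (CommutativeRing)
open import Relation.Binary.PropositionalEquality using (_≡_)

-- Permutations of {1..n}, encoded as injective words σ₁⋯σₙ over Fin n
-- (value i : Fin n stands for i+1; only relative order matters).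

allWords : (m n : ℕ) → List (Vec (Fin n) m)
allWords zero    n = [] ∷ []
allWords (suc m) n = concatMap (λ i → map (i ∷_) (allWords m n)) (allFin n)

notElem : ℕ → List ℕ → Bool
notElem a []       = true
notElem a (b ∷ bs) = if a ≡ᵇ b then false else notElem a bs

distinct : List ℕ → Bool
distinct []       = true
distinct (a ∷ as) = notElem a as ∧ distinct as

word : ∀ {n} → Vec (Fin n) n → List ℕ
word σ = map toℕ (toList σ)

Perms : (n : ℕ) → List (Vec (Fin n) n)
Perms n = filterᵇ (λ σ → distinct (word σ)) (allWords n n)

Statistic : Set
Statistic = (n : ℕ) → Vec (Fin n) n → ℕ

-- 1-based positions j with w_j > w_{j+1}; first argument is the position of the head
descentSet : ℕ → List ℕ → List ℕ
descentSet i []            = []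
descentSet i (a ∷ [])      = []
descentSet i (a ∷ b ∷ rest) =
  if b <ᵇ a then i ∷ descentSet (suc i) (b ∷ rest) else descentSet (suc i) (b ∷ rest)

allGreater : ℕ → List ℕ → Bool
allGreater a []       = true
allGreater a (b ∷ bs) = (a <ᵇ b) ∧ allGreater a bs

rlminL : List ℕ → ℕ
rlminL []       = 0
rlminL (a ∷ as) = (if allGreater a as then 1 else 0) +ℕ rlminL as

des : Statistic
des n σ = length (descentSet 1 (word σ))

maj : Statistic
maj n σ = sum (descentSet 1 (word σ))

rlmin : Statistic
rlmin n σ = rlminL (word σ)

-- Stirling-Euler-Mahonian triples: the trivariate generating functions over
-- 𝔖ₙ agree for every n, i.e. every coefficient of y^a x^b q^c agrees.

jointCount : Statistic → Statistic → Statistic → (n a b c : ℕ) → ℕ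
jointCount S E M n a b c =
  length (filterᵇ (λ σ → (S n σ ≡ᵇ a) ∧ ((E n σ ≡ᵇ b) ∧ (M n σ ≡ᵇ c))) (Perms n))

StirlingEulerMahonian : Statistic → Statistic → Statistic → Set
StirlingEulerMahonian S E M =
  ∀ n a b c → jointCount S E M n a b c ≡ jointCount rlmin des maj n a b c

-- The real parameter y enters only through
--   t = q^y   and   u = [y]_q = (1 - q^y)/(1 - q),
-- which are taken as ring elements subject to (1 - q) u = 1 - t
-- (and q invertible, with inverse qinv).

module QAnalogues {c ℓ} (R : CommutativeRing c ℓ) where
  open CommutativeRing R

  pow : Carrier → ℕ → Carrier
  pow x zero    = 1#
  pow x (suc m) = x * pow x m

  sumL : List Carrier → Carrier
  sumL []       = 0#
  sumL (x ∷ xs) = x + sumL xs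

  qnat : Carrier → ℕ → Carrier
  qnat q zero    = 0#
  qnat q (suc m) = 1# + q * qnat q m

  qint : (q qinv : Carrier) → ℤ → Carrier
  qint q qinv (+ m)      = qnat q m
  qint q qinv -[1+ m ]   = - (pow qinv (suc m) * qnat q (suc m))

  -- [y + m]_q = [y]_q + q^y [m]_q
  qshift : (q t u : Carrier) → ℕ → Carrier
  qshift q t u m = u + t * qnat q m

  -- ⟨n, k⟩_{q,y} = Σ_{σ ∈ 𝔖ₙ, E σ = k-1} [y]_q^{S σ} q^{(n - S σ)(y-1) + M σ}
  -- with q^{(n-s)(y-1)} = (t · qinv)^{n-s}  (S σ ≤ n for SEM triples).
  -- The condition E σ = k - 1 is written E σ + 1 = k (so k = 0 gives 0).
  eulerianBracket : (S E M : Statistic) (q qinv t u : Carrier) (n k : ℕ) → Carrier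
  eulerianBracket S E M q qinv t u n k =
    sumL (map (λ σ → pow u (S n σ) * (pow (t * qinv) (n ∸ S n σ) * pow q (M n σ)))
              (filterᵇ (λ σ → suc (E n σ) ≡ᵇ k) (Perms n)))

-- The permutations of size n + 1 are exactly
-- the insertions of the largest letter n into the permutations of size n, each obtained once, so
-- the bracket at n + 1 is a double sum: over σ ∈ 𝔖ₙ and over the n + 1 positions for n.  Inserting
-- n at the end adds a right-to-left minimum and changes neither des nor maj.  Inserting it in
-- front of one of the L letters of a word with d descents and major index m keeps rlmin, and yields
-- the pairs (des, maj) = (d, m + j) for 1 ≤ j ≤ d and (d + 1, m + j) for d < j ≤ L.  Collecting the
-- q-powers gives the two terms of the recurrence.  A Stirling-Euler-Mahonian triple enters only
-- through the multiset of its values on 𝔖ₙ, which is that of (rlmin, des, maj).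
module Submission where

open import Defs
open import Data.Nat using (ℕ; _≤_; _∸_)
open import Data.Integer using (_⊖_)
open import Algebra.Bundles using (CommutativeRing)
open import Data.Nat using (suc; s≤s; z≤n)

module Permutations where

  import Algebra.Properties.CommutativeSemigroup as CommutativeSemigroupProperties
  open import Data.Bool using (Bool; true; false; T; _∧_; if_then_else_)
  open import Data.Bool.Properties using (T-∧; T-≡; if-float)
  open import Data.Empty using (⊥-elim)
  open import Data.Fin as Fin using (Fin; toℕ)
  open import Data.List using (List; []; _∷_; _++_; [_]; length; map; filterᵇ; concatMap; upTo; applyUpTo; allFin)
  import Data.List as List
  open import Data.List.Membership.Propositional using (_∈_)
  open import Data.List.Membership.Propositional.Properties using (∈-∃++)
  open import Data.List.Properties
    using (≡-dec; filter-++; length-++; length-map; map-++; map-∘; map-upTo; map-tabulate; map-concatMap;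
           concatMap-cong; concatMap-map; map-cong-local)
  open import Data.List.Relation.Binary.Permutation.Propositional using (_↭_; ↭-refl; ↭-prep; ↭-sym; ↭-trans)
  open import Data.List.Relation.Binary.Permutation.Propositional.Properties using (shift) renaming (map⁺ to ↭-map⁺)
  open import Data.List.Relation.Unary.All using (All; []; _∷_; tabulate)
  import Data.List.Relation.Unary.All as All
  import Data.List.Relation.Unary.All.Properties as All
  open import Data.List.Relation.Unary.Any using (here; there)
  open import Data.Nat using (zero; _+_; _*_; _<_; s≤s⁻¹; _≡ᵇ_; _<ᵇ_)
  import Data.Nat as ℕ
  open import Data.Nat.ListAction using (sum)
  open import Data.Nat.Properties
    using (+-identityʳ; +-comm; +-suc; +-cancelˡ-≡; +-mono-≤; +-commutativeSemigroup; suc-injective;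
           ≤-refl; <-irrefl; <⇒≤; <⇒≱; <⇒≢; >⇒≢; ≤∧≢⇒<; m<n⇒m<1+n; m≤n⇒m≤1+n; ≡ᵇ⇒≡; ≡⇒≡ᵇ; <ᵇ⇒<; <⇒<ᵇ)
  open import Data.Product using (_×_; _,_; proj₁; proj₂)
  open import Data.Unit using (tt)
  open import Data.Vec using (Vec; toList) renaming (_∷_ to _∷ᵥ_)
  open import Function using (_∘_)
  open import Function.Bundles using (module Equivalence)
  open import Relation.Binary.Definitions using (DecidableEquality)
  open import Relation.Binary.PropositionalEquality hiding ([_])
  open import Relation.Nullary using (¬_; does; yes; no)
  open import Relation.Nullary.Decidable using (map′; _×-dec_)

  open Equivalence using (to; from)
  open CommutativeSemigroupProperties +-commutativeSemigroup using (x∙yz≈y∙xz)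

  𝟙 : Bool → ℕ
  𝟙 true  = 1
  𝟙 false = 0

  module Multiplicity {A : Set} (_≟_ : DecidableEquality A) where

    multiplicity : A → List A → ℕ
    multiplicity x xs = length (filterᵇ (λ y → does (y ≟ x)) xs)

    multiplicity-++ : ∀ x xs ys → multiplicity x (xs ++ ys) ≡ multiplicity x xs + multiplicity x ys
    multiplicity-++ x xs ys = trans (cong length (filter-++ _ xs ys)) (length-++ (filterᵇ _ xs))

    multiplicity-∷ : ∀ x y ys → multiplicity x (y ∷ ys) ≡ 𝟙 (does (y ≟ x)) + multiplicity x ys
    multiplicity-∷ x y ys with y ≟ x
    ... | yes _ = refl
    ... | no  _ = refl

    multiplicity-∷-≡ : ∀ x xs → multiplicity x (x ∷ xs) ≡ suc (multiplicity x xs)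
    multiplicity-∷-≡ x xs with x ≟ x
    ... | yes _   = refl
    ... | no  x≢x = ⊥-elim (x≢x refl)

    multiplicity-sum : ∀ x xs → multiplicity x xs ≡ sum (map (λ y → 𝟙 (does (y ≟ x))) xs)
    multiplicity-sum x []       = refl
    multiplicity-sum x (y ∷ xs) = trans (multiplicity-∷ x y xs) (cong (𝟙 (does (y ≟ x)) +_) (multiplicity-sum x xs))

    multiplicity-concatMap : ∀ {B : Set} (f : B → List A) x bs →
      multiplicity x (concatMap f bs) ≡ sum (map (multiplicity x ∘ f) bs)
    multiplicity-concatMap f x []       = refl
    multiplicity-concatMap f x (b ∷ bs) =
      trans (multiplicity-++ x (f b) (concatMap f bs)) (cong (multiplicity x (f b) +_) (multiplicity-concatMap f x bs))

    multiplicity-filterᵇ : ∀ (p : A → Bool) x xs →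
      multiplicity x (filterᵇ p xs) ≡ (if p x then multiplicity x xs else 0)
    multiplicity-filterᵇ p x [] with p x
    ... | true  = refl
    ... | false = refl
    multiplicity-filterᵇ p x (y ∷ xs) with p y in py
    ... | true with y ≟ x
    ...   | yes refl rewrite multiplicity-filterᵇ p y xs | py = refl
    ...   | no  _    = multiplicity-filterᵇ p x xs
    multiplicity-filterᵇ p x (y ∷ xs) | false with y ≟ x
    ...   | yes refl rewrite multiplicity-filterᵇ p y xs | py = refl
    ...   | no  _    = multiplicity-filterᵇ p x xs

    multiplicity≢0⇒∈ : ∀ {x} ys → multiplicity x ys ≢ 0 → x ∈ ys
    multiplicity≢0⇒∈     []       m≢0 = ⊥-elim (m≢0 refl)
    multiplicity≢0⇒∈ {x} (y ∷ ys) m≢0 with y ≟ x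
    ... | yes refl = here refl
    ... | no  _    = there (multiplicity≢0⇒∈ ys m≢0)

    ∈⇒multiplicity≢0 : ∀ {x xs} → x ∈ xs → multiplicity x xs ≢ 0
    ∈⇒multiplicity≢0 {x} {_ ∷ xs} (here refl) rewrite multiplicity-∷-≡ x xs = λ ()
    ∈⇒multiplicity≢0 {x} {y ∷ xs} (there x∈xs) with y ≟ x
    ... | yes _ = λ ()
    ... | no  _ = ∈⇒multiplicity≢0 x∈xs

    ↭-of-multiplicities : ∀ xs ys → (∀ z → multiplicity z xs ≡ multiplicity z ys) → xs ↭ ys
    ↭-of-multiplicities []       []       _    = ↭-refl
    ↭-of-multiplicities []       (y ∷ ys) same with () ← trans (same y) (multiplicity-∷-≡ y ys)
    ↭-of-multiplicities (x ∷ xs) ys       same with ∈-∃++ (multiplicity≢0⇒∈ ys x-occurs)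
      where
      x-occurs : multiplicity x ys ≢ 0
      x-occurs m≡0 with () ← trans (sym (multiplicity-∷-≡ x xs)) (trans (same x) m≡0)
    ... | ys₁ , ys₂ , refl =
      ↭-trans (↭-prep x (↭-of-multiplicities xs (ys₁ ++ ys₂) same′)) (↭-sym (shift x ys₁ ys₂))
      where
      same′ : ∀ z → multiplicity z xs ≡ multiplicity z (ys₁ ++ ys₂)
      same′ z = +-cancelˡ-≡ (m [ x ]) _ _ (begin
        m [ x ] + m xs            ≡⟨ multiplicity-++ z [ x ] xs ⟨
        m (x ∷ xs)                ≡⟨ same z ⟩
        m (ys₁ ++ x ∷ ys₂)        ≡⟨ multiplicity-++ z ys₁ (x ∷ ys₂) ⟩
        m ys₁ + m ([ x ] ++ ys₂)  ≡⟨ cong (m ys₁ +_) (multiplicity-++ z [ x ] ys₂) ⟩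
        m ys₁ + (m [ x ] + m ys₂) ≡⟨ x∙yz≈y∙xz (m ys₁) (m [ x ]) (m ys₂) ⟩
        m [ x ] + (m ys₁ + m ys₂) ≡⟨ cong (m [ x ] +_) (multiplicity-++ z ys₁ ys₂) ⟨
        m [ x ] + m (ys₁ ++ ys₂)  ∎)
        where
        open ≡-Reasoning
        m = multiplicity z

  ¬T⇒≡false : ∀ {b} → ¬ T b → b ≡ false
  ¬T⇒≡false {true}  ¬t = ⊥-elim (¬t tt)
  ¬T⇒≡false {false} _  = refl

  ≡ᵇ-false : ∀ {m n} → m ≢ n → (m ≡ᵇ n) ≡ false
  ≡ᵇ-false {m} {n} m≢n = ¬T⇒≡false (m≢n ∘ ≡ᵇ⇒≡ m n)

  <ᵇ-false : ∀ {m n} → m ≤ n → (n <ᵇ m) ≡ false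
  <ᵇ-false {m} {n} m≤n = ¬T⇒≡false (λ n<m → <⇒≱ (<ᵇ⇒< n m n<m) m≤n)

  allBelow : ℕ → List ℕ → Bool
  allBelow n []       = true
  allBelow n (x ∷ xs) = (x <ᵇ n) ∧ allBelow n xs

  allBelow-∷ : ∀ n x w → T (allBelow n (x ∷ w)) → x < n × T (allBelow n w)
  allBelow-∷ n x w h = <ᵇ⇒< x n (proj₁ (to T-∧ h)) , proj₂ (to T-∧ h)

  allBelow-∷⁺ : ∀ n x w → x < n → T (allBelow n w) → T (allBelow n (x ∷ w))
  allBelow-∷⁺ n x w x<n h = from T-∧ (<⇒<ᵇ x<n , h)

  words : ℕ → ℕ → List (List ℕ)
  words zero    n = [ [] ]
  words (suc m) n = concatMap (λ i → map (i ∷_) (words m n)) (upTo n)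

  letters : ∀ {m n} → Vec (Fin n) m → List ℕ
  letters σ = map toℕ (toList σ)

  map-toℕ-allFin : ∀ n → map toℕ (allFin n) ≡ upTo n
  map-toℕ-allFin zero    = refl
  map-toℕ-allFin (suc n) = cong (0 ∷_) (begin
    map toℕ (List.tabulate Fin.suc) ≡⟨ map-tabulate Fin.suc toℕ ⟩
    List.tabulate (suc ∘ toℕ)       ≡⟨ map-tabulate toℕ suc ⟨
    map suc (List.tabulate toℕ)     ≡⟨ cong (map suc) (map-tabulate (λ i → i) toℕ) ⟨
    map suc (map toℕ (allFin n))    ≡⟨ cong (map suc) (map-toℕ-allFin n) ⟩
    map suc (upTo n)                ≡⟨ map-upTo suc n ⟩
    applyUpTo suc n                 ∎)
    where open ≡-Reasoning

  letters-allWords : ∀ m n → map letters (allWords m n) ≡ words m n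
  letters-allWords zero    n = refl
  letters-allWords (suc m) n = begin
    map letters (concatMap (λ i → map (i ∷ᵥ_) (allWords m n)) (allFin n))
      ≡⟨ map-concatMap letters (λ i → map (i ∷ᵥ_) (allWords m n)) (allFin n) ⟩
    concatMap (λ i → map letters (map (i ∷ᵥ_) (allWords m n))) (allFin n)
      ≡⟨ concatMap-cong prefix (allFin n) ⟩
    concatMap (λ i → map (toℕ i ∷_) (words m n)) (allFin n)
      ≡⟨ concatMap-map (λ j → map (j ∷_) (words m n)) toℕ (allFin n) ⟨
    concatMap (λ j → map (j ∷_) (words m n)) (map toℕ (allFin n))
      ≡⟨ cong (concatMap (λ j → map (j ∷_) (words m n))) (map-toℕ-allFin n) ⟩
    words (suc m) n ∎
    where
    open ≡-Reasoning
    prefix : ∀ i → map letters (map (i ∷ᵥ_) (allWords m n)) ≡ map (toℕ i ∷_) (words m n)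
    prefix i = begin
      map letters (map (i ∷ᵥ_) (allWords m n))    ≡⟨ map-∘ (allWords m n) ⟨
      map (letters ∘ (i ∷ᵥ_)) (allWords m n)      ≡⟨ map-∘ {g = toℕ i ∷_} {f = letters} (allWords m n) ⟩
      map (toℕ i ∷_) (map letters (allWords m n)) ≡⟨ cong (map (toℕ i ∷_)) (letters-allWords m n) ⟩
      map (toℕ i ∷_) (words m n)                  ∎

  map-filterᵇ : ∀ {A B : Set} (f : A → B) (p : B → Bool) xs → map f (filterᵇ (p ∘ f) xs) ≡ filterᵇ p (map f xs)
  map-filterᵇ f p []       = refl
  map-filterᵇ f p (x ∷ xs) with p (f x)
  ... | true  = cong (f x ∷_) (map-filterᵇ f p xs)
  ... | false = map-filterᵇ f p xs

  open Multiplicity ℕ._≟_ using () renaming (multiplicity to letterMultiplicity)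

  letterMultiplicity-suc : ∀ x xs → letterMultiplicity (suc x) (map suc xs) ≡ letterMultiplicity x xs
  letterMultiplicity-suc x []       = refl
  letterMultiplicity-suc x (y ∷ xs) with y ≡ᵇ x
  ... | true  = cong suc (letterMultiplicity-suc x xs)
  ... | false = letterMultiplicity-suc x xs

  letterMultiplicity-0-suc : ∀ xs → letterMultiplicity 0 (map suc xs) ≡ 0
  letterMultiplicity-0-suc []       = refl
  letterMultiplicity-0-suc (_ ∷ xs) = letterMultiplicity-0-suc xs

  letterMultiplicity-upTo : ∀ x n → letterMultiplicity x (upTo n) ≡ 𝟙 (x <ᵇ n)
  letterMultiplicity-upTo x       zero    = refl
  letterMultiplicity-upTo zero    (suc n) rewrite sym (map-upTo suc n) =
    cong suc (letterMultiplicity-0-suc (upTo n))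
  letterMultiplicity-upTo (suc x) (suc n) rewrite sym (map-upTo suc n) =
    trans (letterMultiplicity-suc x (upTo n)) (letterMultiplicity-upTo x n)

  _≟ₗ_ : DecidableEquality (List ℕ)
  _≟ₗ_ = ≡-dec ℕ._≟_

  open Multiplicity _≟ₗ_

  multiplicity-map-∷ : ∀ x w i W → multiplicity (x ∷ w) (map (i ∷_) W) ≡ (if i ≡ᵇ x then multiplicity w W else 0)
  multiplicity-map-∷ x w i []      with i ≡ᵇ x
  ... | true  = refl
  ... | false = refl
  multiplicity-map-∷ x w i (v ∷ W) with i ≡ᵇ x | multiplicity-map-∷ x w i W
  ... | false | ih = ih
  ... | true  | ih with does (v ≟ₗ w)
  ...   | true  = cong suc ih
  ...   | false = ih

  multiplicity-[]-map-∷ : ∀ i W → multiplicity [] (map (i ∷_) W) ≡ 0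
  multiplicity-[]-map-∷ i []      = refl
  multiplicity-[]-map-∷ i (_ ∷ W) = multiplicity-[]-map-∷ i W

  multiplicity-prefixes : ∀ x w I W →
    multiplicity (x ∷ w) (concatMap (λ i → map (i ∷_) W) I) ≡ letterMultiplicity x I * multiplicity w W
  multiplicity-prefixes x w []      W = refl
  multiplicity-prefixes x w (i ∷ I) W
    rewrite multiplicity-++ (x ∷ w) (map (i ∷_) W) (concatMap (λ i → map (i ∷_) W) I)
          | multiplicity-map-∷ x w i W | multiplicity-prefixes x w I W
    with i ≡ᵇ x
  ... | true  = refl
  ... | false = refl

  multiplicity-[]-prefixes : ∀ I W → multiplicity [] (concatMap (λ i → map (i ∷_) W) I) ≡ 0
  multiplicity-[]-prefixes []      W = refl
  multiplicity-[]-prefixes (i ∷ I) W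
    rewrite multiplicity-++ [] (map (i ∷_) W) (concatMap (λ i → map (i ∷_) W) I)
          | multiplicity-[]-map-∷ i W = multiplicity-[]-prefixes I W

  multiplicity-words : ∀ m n w → multiplicity w (words m n) ≡ 𝟙 ((length w ≡ᵇ m) ∧ allBelow n w)
  multiplicity-words zero    n []      = refl
  multiplicity-words zero    n (x ∷ w) = refl
  multiplicity-words (suc m) n []      = multiplicity-[]-prefixes (upTo n) (words m n)
  multiplicity-words (suc m) n (x ∷ w) =
    trans (multiplicity-prefixes x w (upTo n) (words m n))
          (trans (cong₂ _*_ (letterMultiplicity-upTo x n) (multiplicity-words m n w))
                 (indicators (x <ᵇ n) (length w ≡ᵇ m) (allBelow n w)))
    where
    indicators : ∀ a b c → 𝟙 a * 𝟙 (b ∧ c) ≡ 𝟙 (b ∧ (a ∧ c))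
    indicators true  b     c = +-identityʳ (𝟙 (b ∧ c))
    indicators false true  c = refl
    indicators false false c = refl

  isPerm : ℕ → List ℕ → Bool
  isPerm n w = distinct w ∧ ((length w ≡ᵇ n) ∧ allBelow n w)

  isPerm⇒ : ∀ n w → T (isPerm n w) → T (distinct w) × length w ≡ n × T (allBelow n w)
  isPerm⇒ n w h with d , h′ ← to T-∧ h with l , a ← to T-∧ h′ = d , ≡ᵇ⇒≡ (length w) n l , a

  isPerm⇐ : ∀ n w → T (distinct w) → length w ≡ n → T (allBelow n w) → T (isPerm n w)
  isPerm⇐ n w d l a = from T-∧ (d , from T-∧ (≡⇒≡ᵇ (length w) n l , a))

  multiplicity-Perms : ∀ n w → multiplicity w (map word (Perms n)) ≡ 𝟙 (isPerm n w)
  multiplicity-Perms n w = begin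
    multiplicity w (map word (Perms n))
      ≡⟨ cong (multiplicity w) (map-filterᵇ letters distinct (allWords n n)) ⟩
    multiplicity w (filterᵇ distinct (map letters (allWords n n)))
      ≡⟨ cong (multiplicity w ∘ filterᵇ distinct) (letters-allWords n n) ⟩
    multiplicity w (filterᵇ distinct (words n n))
      ≡⟨ multiplicity-filterᵇ distinct w (words n n) ⟩
    (if distinct w then multiplicity w (words n n) else 0)
      ≡⟨ cong (if distinct w then_else 0) (multiplicity-words n n w) ⟩
    (if distinct w then 𝟙 ((length w ≡ᵇ n) ∧ allBelow n w) else 0)
      ≡⟨ if-𝟙 (distinct w) ⟩
    𝟙 (isPerm n w) ∎
    where
    open ≡-Reasoning
    if-𝟙 : ∀ a {b} → (if a then 𝟙 b else 0) ≡ 𝟙 (a ∧ b)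
    if-𝟙 true  = refl
    if-𝟙 false = refl

  delete : ℕ → List ℕ → List ℕ
  delete a []       = []
  delete a (b ∷ bs) = if a ≡ᵇ b then bs else b ∷ delete a bs

  allBelow⇒notElem : ∀ n w → T (allBelow n w) → T (notElem n w)
  allBelow⇒notElem n []      _ = tt
  allBelow⇒notElem n (x ∷ w) h with x<n , h′ ← allBelow-∷ n x w h rewrite ≡ᵇ-false (>⇒≢ x<n) =
    allBelow⇒notElem n w h′

  allBelow-suc : ∀ n w → T (allBelow n w) → T (allBelow (suc n) w)
  allBelow-suc n []      _ = tt
  allBelow-suc n (x ∷ w) h with x<n , h′ ← allBelow-∷ n x w h =
    allBelow-∷⁺ (suc n) x w (m<n⇒m<1+n x<n) (allBelow-suc n w h′)

  allBelow-suc⁻ : ∀ n w → T (allBelow (suc n) w) → T (notElem n w) → T (allBelow n w)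
  allBelow-suc⁻ n []      _ _ = tt
  allBelow-suc⁻ n (x ∷ w) h n∉ with n ≡ᵇ x in eq
  ... | false with x<1+n , h′ ← allBelow-∷ (suc n) x w h =
    allBelow-∷⁺ n x w (≤∧≢⇒< (s≤s⁻¹ x<1+n) (λ x≡n → subst T eq (≡⇒≡ᵇ n x (sym x≡n)))) (allBelow-suc⁻ n w h′ n∉)

  notElem-≢ : ∀ a b w → a ≢ b → notElem a (b ∷ w) ≡ notElem a w
  notElem-≢ a b w a≢b rewrite ≡ᵇ-false a≢b = refl

  length-delete : ∀ a w → notElem a w ≡ false → length w ≡ suc (length (delete a w))
  length-delete a (x ∷ w) a∈ with a ≡ᵇ x
  ... | true  = refl
  ... | false = cong suc (length-delete a w a∈)

  allBelow-delete : ∀ m a w → T (allBelow m w) → T (allBelow m (delete a w))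
  allBelow-delete m a []      _ = tt
  allBelow-delete m a (x ∷ w) h with a ≡ᵇ x | allBelow-∷ m x w h
  ... | true  | _   , h′ = h′
  ... | false | x<m , h′ = allBelow-∷⁺ m x (delete a w) x<m (allBelow-delete m a w h′)

  allBelow-delete⁻ : ∀ m a w → notElem a w ≡ false → a < m → T (allBelow m (delete a w)) → T (allBelow m w)
  allBelow-delete⁻ m a (x ∷ w) a∈ a<m h with a ≡ᵇ x in eq
  ... | true rewrite ≡ᵇ⇒≡ a x (from T-≡ eq) = allBelow-∷⁺ m x w a<m h
  ... | false with x<m , h′ ← allBelow-∷ m x (delete a w) h =
    allBelow-∷⁺ m x w x<m (allBelow-delete⁻ m a w a∈ a<m h′)

  notElem-delete : ∀ x a w → T (notElem x w) → T (notElem x (delete a w))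
  notElem-delete x a []      _  = tt
  notElem-delete x a (y ∷ w) x∉ with x ≡ᵇ y in eq | a ≡ᵇ y
  ... | false | true  = x∉
  ... | false | false rewrite eq = notElem-delete x a w x∉

  notElem-delete-≢ : ∀ x a w → x ≢ a → notElem x (delete a w) ≡ notElem x w
  notElem-delete-≢ x a []      _   = refl
  notElem-delete-≢ x a (y ∷ w) x≢a with a ≡ᵇ y in eq
  ... | true rewrite ≡ᵇ⇒≡ a y (from T-≡ eq) = sym (notElem-≢ x y w x≢a)
  ... | false with x ≡ᵇ y
  ...   | true  = refl
  ...   | false = notElem-delete-≢ x a w x≢a

  distinct-delete : ∀ a w → T (distinct w) → T (distinct (delete a w))
  distinct-delete a []      _ = tt
  distinct-delete a (x ∷ w) h with a ≡ᵇ x | to T-∧ h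
  ... | true  | _  , d = d
  ... | false | x∉ , d = from T-∧ (notElem-delete x a w x∉ , distinct-delete a w d)

  notElem-delete-self : ∀ a w → T (distinct w) → T (notElem a (delete a w))
  notElem-delete-self a []      _ = tt
  notElem-delete-self a (x ∷ w) h with a ≡ᵇ x in eq | to T-∧ h
  ... | true  | x∉ , _ rewrite ≡ᵇ⇒≡ a x (from T-≡ eq) = x∉
  ... | false | _  , d rewrite eq = notElem-delete-self a w d

  distinct-delete⁻ : ∀ a w → notElem a w ≡ false →
    T (notElem a (delete a w)) → T (distinct (delete a w)) → T (distinct w)
  distinct-delete⁻ a (x ∷ w) a∈ a∉ h with a ≡ᵇ x in eq
  ... | true rewrite ≡ᵇ⇒≡ a x (from T-≡ eq) = from T-∧ (a∉ , h)
  ... | false with x∉ , d ← to T-∧ h =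
    from T-∧ ( subst T (notElem-delete-≢ x a w (a≢x ∘ sym)) x∉
             , distinct-delete⁻ a w a∈ (subst T (notElem-≢ a x (delete a w) a≢x) a∉) d)
    where
    a≢x : a ≢ x
    a≢x a≡x = subst T eq (≡⇒≡ᵇ a x a≡x)

  pigeonhole : ∀ m w → T (distinct w) → T (allBelow m w) → length w ≤ m
  pigeonhole zero    []      _ _ = z≤n
  pigeonhole zero    (x ∷ w) _ h with () ← proj₁ (allBelow-∷ zero x w h)
  pigeonhole (suc m) w d h with notElem m w in eq
  ... | true  = m≤n⇒m≤1+n (pigeonhole m w d (allBelow-suc⁻ m w h (from T-≡ eq)))
  ... | false rewrite length-delete m w eq =
    s≤s (pigeonhole m (delete m w) (distinct-delete m w d)
          (allBelow-suc⁻ m (delete m w) (allBelow-delete (suc m) m w h) (notElem-delete-self m w d)))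

  isPerm-suc⇒ : ∀ n w → T (isPerm (suc n) w) → notElem n w ≡ false × T (isPerm n (delete n w))
  isPerm-suc⇒ n w h with d , l , a ← isPerm⇒ (suc n) w h | notElem n w in eq
  ... | true  = ⊥-elim (<-irrefl refl (subst (_≤ n) l (pigeonhole n w d (allBelow-suc⁻ n w a (from T-≡ eq)))))
  ... | false =
    refl , isPerm⇐ n (delete n w) (distinct-delete n w d) (suc-injective (trans (sym (length-delete n w eq)) l))
             (allBelow-suc⁻ n (delete n w) (allBelow-delete (suc n) n w a) (notElem-delete-self n w d))

  isPerm-suc⇐ : ∀ n w → notElem n w ≡ false → T (isPerm n (delete n w)) → T (isPerm (suc n) w)
  isPerm-suc⇐ n w n∈ h with d , l , a ← isPerm⇒ n (delete n w) h =
    isPerm⇐ (suc n) w (distinct-delete⁻ n w n∈ (allBelow⇒notElem n (delete n w) a) d)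
      (trans (length-delete n w n∈) (cong suc l))
      (allBelow-delete⁻ (suc n) n w n∈ ≤-refl (allBelow-suc n (delete n w) a))

  isPerm-suc : ∀ n w → isPerm (suc n) w ≡ (if notElem n w then false else isPerm n (delete n w))
  isPerm-suc n w with isPerm (suc n) w in e₁ | notElem n w in e₂ | isPerm n (delete n w) in e₃
  ... | true  | true  | _     with () ← trans (sym e₂) (proj₁ (isPerm-suc⇒ n w (from T-≡ e₁)))
  ... | true  | false | true  = refl
  ... | true  | false | false with () ← subst T e₃ (proj₂ (isPerm-suc⇒ n w (from T-≡ e₁)))
  ... | false | true  | _     = refl
  ... | false | false | true  with () ← subst T e₁ (isPerm-suc⇐ n w e₂ (from T-≡ e₃))
  ... | false | false | false = refl

  -- Inserting the largest letter

  insertions : ℕ → List ℕ → List (List ℕ)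
  insertions n []      = [ [ n ] ]
  insertions n (a ∷ v) = (n ∷ a ∷ v) ∷ map (a ∷_) (insertions n v)

  multiplicity-insertions : ∀ n v w → T (allBelow n v) →
    multiplicity w (insertions n v) ≡ (if notElem n w then 0 else 𝟙 (does (v ≟ₗ delete n w)))
  multiplicity-insertions n []      []      _ = refl
  multiplicity-insertions n []      (x ∷ w) _ rewrite multiplicity-∷ (x ∷ w) [ n ] [] with n ≡ᵇ x
  ... | true  = +-identityʳ _
  ... | false with notElem n w
  ...   | true  = refl
  ...   | false = refl
  multiplicity-insertions n (a ∷ v) []      _ = multiplicity-[]-map-∷ a (insertions n v)
  multiplicity-insertions n (a ∷ v) (x ∷ w) h
    rewrite multiplicity-∷ (x ∷ w) (n ∷ a ∷ v) (map (a ∷_) (insertions n v))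
          | multiplicity-map-∷ x w a (insertions n v)
    with n ≡ᵇ x in n≡ᵇx
  ... | true
    rewrite ≡ᵇ-false {a} {x} (λ a≡x → <⇒≢ (proj₁ (allBelow-∷ n a v h)) (trans a≡x (sym (≡ᵇ⇒≡ n x (from T-≡ n≡ᵇx)))))
    = +-identityʳ _
  ... | false rewrite multiplicity-insertions n v w (proj₂ (allBelow-∷ n a v h)) with a ≡ᵇ x
  ...   | true  = refl
  ...   | false with notElem n w
  ...     | true  = refl
  ...     | false = refl

  permsByInsertion : ℕ → List (List ℕ)
  permsByInsertion zero    = [ [] ]
  permsByInsertion (suc n) = concatMap (insertions n) (permsByInsertion n)

  multiplicity-permsByInsertion : ∀ n w → multiplicity w (permsByInsertion n) ≡ 𝟙 (isPerm n w)
  isPerm-member : ∀ n {v} → v ∈ permsByInsertion n → T (isPerm n v)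

  multiplicity-permsByInsertion zero    []      = refl
  multiplicity-permsByInsertion zero    (x ∷ w) with distinct (x ∷ w)
  ... | true  = refl
  ... | false = refl
  multiplicity-permsByInsertion (suc n) w = begin
    multiplicity w (concatMap (insertions n) (permsByInsertion n))
      ≡⟨ multiplicity-concatMap (insertions n) w (permsByInsertion n) ⟩
    sum (map (λ v → multiplicity w (insertions n v)) (permsByInsertion n))
      ≡⟨ cong sum (map-cong-local (tabulate (λ {v} v∈ → multiplicity-insertions n v w (below v∈)))) ⟩
    sum (map (λ v → if notElem n w then 0 else 𝟙 (does (v ≟ₗ delete n w))) (permsByInsertion n))
      ≡⟨ sum-if (notElem n w) ⟩
    (if notElem n w then 0 else multiplicity (delete n w) (permsByInsertion n))
      ≡⟨ cong (if notElem n w then 0 else_) (multiplicity-permsByInsertion n (delete n w)) ⟩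
    (if notElem n w then 0 else 𝟙 (isPerm n (delete n w)))
      ≡⟨ if-float 𝟙 (notElem n w) ⟨
    𝟙 (if notElem n w then false else isPerm n (delete n w))
      ≡⟨ cong 𝟙 (isPerm-suc n w) ⟨
    𝟙 (isPerm (suc n) w) ∎
    where
    open ≡-Reasoning
    below : ∀ {v} → v ∈ permsByInsertion n → T (allBelow n v)
    below {v} v∈ = proj₂ (proj₂ (isPerm⇒ n v (isPerm-member n v∈)))
    sum-if : ∀ b → sum (map (λ v → if b then 0 else 𝟙 (does (v ≟ₗ delete n w))) (permsByInsertion n))
                   ≡ (if b then 0 else multiplicity (delete n w) (permsByInsertion n))
    sum-if true  = sum-zeros (permsByInsertion n)
      where
      sum-zeros : ∀ (vs : List (List ℕ)) → sum (map (λ _ → 0) vs) ≡ 0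
      sum-zeros []       = refl
      sum-zeros (_ ∷ vs) = sum-zeros vs
    sum-if false = sym (multiplicity-sum (delete n w) (permsByInsertion n))

  isPerm-member n {v} v∈ with isPerm n v in eq
  ... | true  = tt
  ... | false = ⊥-elim (∈⇒multiplicity≢0 v∈ (trans (multiplicity-permsByInsertion n v) (cong 𝟙 eq)))

  word↭permsByInsertion : ∀ n → map word (Perms n) ↭ permsByInsertion n
  word↭permsByInsertion n = ↭-of-multiplicities (map word (Perms n)) (permsByInsertion n)
    (λ w → trans (multiplicity-Perms n w) (sym (multiplicity-permsByInsertion n w)))

  -- Descents and major index of words

  desL : List ℕ → ℕ
  desL w = length (descentSet 1 w)

  majL : List ℕ → ℕ
  majL w = sum (descentSet 1 w)

  startsBelow : ℕ → List ℕ → Bool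
  startsBelow a []      = false
  startsBelow a (b ∷ _) = b <ᵇ a

  descentSet-suc : ∀ i w → descentSet (suc i) w ≡ map suc (descentSet i w)
  descentSet-suc i []          = refl
  descentSet-suc i (a ∷ [])    = refl
  descentSet-suc i (a ∷ b ∷ w) with b <ᵇ a | descentSet-suc (suc i) (b ∷ w)
  ... | true  | ih = cong (suc i ∷_) ih
  ... | false | ih = ih

  length-descentSet-2 : ∀ w → length (descentSet 2 w) ≡ desL w
  length-descentSet-2 w = trans (cong length (descentSet-suc 1 w)) (length-map suc (descentSet 1 w))

  sum-descentSet-2 : ∀ w → sum (descentSet 2 w) ≡ majL w + desL w
  sum-descentSet-2 w =
    trans (cong sum (descentSet-suc 1 w)) (trans (sum-map-suc (descentSet 1 w)) (+-comm (desL w) (majL w)))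
    where
    sum-map-suc : ∀ xs → sum (map suc xs) ≡ length xs + sum xs
    sum-map-suc []       = refl
    sum-map-suc (x ∷ xs) = cong suc (trans (cong (x +_) (sum-map-suc xs)) (x∙yz≈y∙xz x (length xs) (sum xs)))

  desL-∷ : ∀ a w → desL (a ∷ w) ≡ 𝟙 (startsBelow a w) + desL w
  desL-∷ a []      = refl
  desL-∷ a (b ∷ w) with b <ᵇ a
  ... | true  = cong suc (length-descentSet-2 (b ∷ w))
  ... | false = length-descentSet-2 (b ∷ w)

  majL-∷ : ∀ a w → majL (a ∷ w) ≡ 𝟙 (startsBelow a w) + (majL w + desL w)
  majL-∷ a []      = refl
  majL-∷ a (b ∷ w) with b <ᵇ a
  ... | true  = cong suc (sum-descentSet-2 (b ∷ w))
  ... | false = sum-descentSet-2 (b ∷ w)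

  desL≤length : ∀ w → desL w ≤ length w
  desL≤length []      = z≤n
  desL≤length (a ∷ w) rewrite desL-∷ a w = +-mono-≤ (𝟙≤1 (startsBelow a w)) (desL≤length w)
    where
    𝟙≤1 : ∀ b → 𝟙 b ≤ 1
    𝟙≤1 true  = ≤-refl
    𝟙≤1 false = z≤n

  rlminL≤length : ∀ w → rlminL w ≤ length w
  rlminL≤length []      = z≤n
  rlminL≤length (a ∷ w) with allGreater a w
  ... | true  = s≤s (rlminL≤length w)
  ... | false = m≤n⇒m≤1+n (rlminL≤length w)

  startsBelow-++-max : ∀ a n v → a < n → startsBelow a (v ++ [ n ]) ≡ startsBelow a v
  startsBelow-++-max a n []      a<n = <ᵇ-false (<⇒≤ a<n)
  startsBelow-++-max a n (_ ∷ _) _   = refl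

  desL-++-max : ∀ n v → T (allBelow n v) → desL (v ++ [ n ]) ≡ desL v
  desL-++-max n []      _ = refl
  desL-++-max n (a ∷ v) h with a<n , h′ ← allBelow-∷ n a v h
    rewrite desL-∷ a (v ++ [ n ]) | desL-∷ a v | startsBelow-++-max a n v a<n | desL-++-max n v h′ = refl

  majL-++-max : ∀ n v → T (allBelow n v) → majL (v ++ [ n ]) ≡ majL v
  majL-++-max n []      _ = refl
  majL-++-max n (a ∷ v) h with a<n , h′ ← allBelow-∷ n a v h
    rewrite majL-∷ a (v ++ [ n ]) | majL-∷ a v | startsBelow-++-max a n v a<n
          | desL-++-max n v h′ | majL-++-max n v h′ = refl

  allGreater-++-max : ∀ a n v → a < n → allGreater a (v ++ [ n ]) ≡ allGreater a v
  allGreater-++-max a n []      a<n rewrite to T-≡ (<⇒<ᵇ a<n) = refl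
  allGreater-++-max a n (b ∷ v) a<n rewrite allGreater-++-max a n v a<n = refl

  rlminL-++-max : ∀ n v → T (allBelow n v) → rlminL (v ++ [ n ]) ≡ suc (rlminL v)
  rlminL-++-max n []      _ = refl
  rlminL-++-max n (a ∷ v) h with a<n , h′ ← allBelow-∷ n a v h
    rewrite allGreater-++-max a n v a<n | rlminL-++-max n v h′ = +-suc _ (rlminL v)

  innerInsertions : ℕ → List ℕ → List (List ℕ)
  innerInsertions n []      = []
  innerInsertions n (a ∷ v) = (n ∷ a ∷ v) ∷ map (a ∷_) (innerInsertions n v)

  insertions-split : ∀ n v → insertions n v ≡ innerInsertions n v ++ [ v ++ [ n ] ]
  insertions-split n []      = refl
  insertions-split n (a ∷ v) = cong ((n ∷ a ∷ v) ∷_)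
    (trans (cong (map (a ∷_)) (insertions-split n v)) (map-++ (a ∷_) (innerInsertions n v) _))

  allGreater-innerInsertions : ∀ c n v → c < n →
    All (λ w → allGreater c w ≡ allGreater c v) (innerInsertions n v)
  allGreater-innerInsertions c n []      _   = []
  allGreater-innerInsertions c n (a ∷ v) c<n =
    cong (_∧ allGreater c (a ∷ v)) (to T-≡ (<⇒<ᵇ c<n))
    ∷ All.map⁺ (All.map (cong ((c <ᵇ a) ∧_)) (allGreater-innerInsertions c n v c<n))

  rlminL-innerInsertions : ∀ n v → T (allBelow n v) → All (λ w → rlminL w ≡ rlminL v) (innerInsertions n v)
  rlminL-innerInsertions n []      _ = []
  rlminL-innerInsertions n (a ∷ v) h with a<n , h′ ← allBelow-∷ n a v h =
    cong (λ b → (if b ∧ allGreater n v then 1 else 0) + rlminL (a ∷ v)) (<ᵇ-false (<⇒≤ a<n))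
    ∷ All.map⁺ (All.zipWith (λ (g , r) → cong₂ (λ b m → (if b then 1 else 0) + m) g r)
                            (allGreater-innerInsertions a n v a<n , rlminL-innerInsertions n v h′))

  -- `does` of this decision is definitionally the conjunction of `_≡ᵇ_` tests filtered by `jointCount`.
  _≟³_ : DecidableEquality (ℕ × ℕ × ℕ)
  (a , b , c) ≟³ (a′ , b′ , c′) =
    map′ (λ { (refl , refl , refl) → refl }) (λ { refl → refl , refl , refl })
         ((a ℕ.≟ a′) ×-dec ((b ℕ.≟ b′) ×-dec (c ℕ.≟ c′)))

  module StatMultiplicity = Multiplicity _≟³_

  stats : Statistic → Statistic → Statistic → (n : ℕ) → Vec (Fin n) n → ℕ × ℕ × ℕ
  stats S E M n σ = S n σ , E n σ , M n σ

  jointCount-multiplicity : ∀ S E M n a b c →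
    jointCount S E M n a b c ≡ StatMultiplicity.multiplicity (a , b , c) (map (stats S E M n) (Perms n))
  jointCount-multiplicity S E M n a b c = trans
    (sym (length-map (stats S E M n) (filterᵇ ((λ x → does (x ≟³ (a , b , c))) ∘ stats S E M n) (Perms n))))
    (cong length (map-filterᵇ (stats S E M n) (λ x → does (x ≟³ (a , b , c))) (Perms n)))

  stats↭ : ∀ S E M → StirlingEulerMahonian S E M → ∀ n →
    map (stats S E M n) (Perms n) ↭ map (stats rlmin des maj n) (Perms n)
  stats↭ S E M sem n = StatMultiplicity.↭-of-multiplicities _ _ λ (a , b , c) →
    trans (sym (jointCount-multiplicity S E M n a b c))
          (trans (sem n a b c) (jointCount-multiplicity rlmin des maj n a b c))

  wordStats : List ℕ → ℕ × ℕ × ℕ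
  wordStats w = rlminL w , desL w , majL w

  stats↭wordStats : ∀ S E M → StirlingEulerMahonian S E M → ∀ n →
    map (stats S E M n) (Perms n) ↭ map wordStats (permsByInsertion n)
  stats↭wordStats S E M sem n = ↭-trans (stats↭ S E M sem n)
    (subst (_↭ map wordStats (permsByInsertion n)) (sym (map-∘ {g = wordStats} {f = word} (Perms n)))
           (↭-map⁺ wordStats (word↭permsByInsertion n)))

module _ {c ℓ} (R : CommutativeRing c ℓ) where

  open import Data.Bool using (Bool; true; false; T; if_then_else_)
  open import Data.Bool.Properties using (T-≡)
  open import Data.Integer.Properties using (⊖-≥)
  open import Data.List using (List; []; _∷_; _++_; [_]; length; map; filterᵇ; concatMap; foldr)
  open import Data.List.Properties using (map-∘)
  open import Data.List.Relation.Binary.Permutation.Propositional using (_↭_; ↭⇒↭ₛ′)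
  open import Data.List.Relation.Binary.Permutation.Propositional.Properties using () renaming (map⁺ to ↭-map⁺)
  open import Data.List.Relation.Binary.Permutation.Setoid.Properties using (foldr-commMonoid)
  open import Data.List.Relation.Unary.All using (All; []; _∷_; tabulate)
  import Data.List.Relation.Unary.All as All
  open import Data.Nat using (zero; _<_; _≡ᵇ_; _<ᵇ_) renaming (_+_ to _+ℕ_)
  import Data.Nat as ℕ
  open import Data.Nat.Properties using (<⇒<ᵇ; <⇒≤; ≡⇒≡ᵇ)
  import Data.Nat.Properties as ℕₚ
  open import Data.Product using (_×_; _,_; proj₁; proj₂)
  open import Function using (_∘_)
  open import Function.Bundles using (module Equivalence)
  open import Relation.Binary.PropositionalEquality as ≡ using (_≡_)
  open import Relation.Nullary using (yes; no)

  open CommutativeRing R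
  open QAnalogues R
  open Permutations
  open Equivalence using (to)
  open import Relation.Binary.Reasoning.Setoid setoid
  open import Algebra.Properties.CommutativeSemigroup +-commutativeSemigroup using (interchange; x∙yz≈y∙xz)
  open import Algebra.Solver.Ring.NaturalCoefficients.Default commutativeSemiring using (solve; _:+_; _:*_; _:=_; con)

  sumMap : ∀ {A : Set} → (A → Carrier) → List A → Carrier
  sumMap f xs = sumL (map f xs)

  sumL≡foldr : ∀ xs → sumL xs ≡ foldr _+_ 0# xs
  sumL≡foldr []       = ≡.refl
  sumL≡foldr (x ∷ xs) = ≡.cong (x +_) (sumL≡foldr xs)

  sumMap-↭ : ∀ {A : Set} (f : A → Carrier) {xs ys} → xs ↭ ys → sumMap f xs ≈ sumMap f ys
  sumMap-↭ f {xs} {ys} xs↭ys = begin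
    sumL (map f xs)         ≡⟨ sumL≡foldr (map f xs) ⟩
    foldr _+_ 0# (map f xs) ≈⟨ foldr-commMonoid setoid +-isCommutativeMonoid (↭⇒↭ₛ′ isEquivalence (↭-map⁺ f xs↭ys)) ⟩
    foldr _+_ 0# (map f ys) ≡⟨ sumL≡foldr (map f ys) ⟨
    sumL (map f ys)         ∎

  sumMap-map : ∀ {A B : Set} (f : B → Carrier) (g : A → B) xs → sumMap f (map g xs) ≡ sumMap (f ∘ g) xs
  sumMap-map f g xs = ≡.cong sumL (≡.sym (map-∘ xs))

  sumMap-cong : ∀ {A : Set} {f g : A → Carrier} {xs} → All (λ x → f x ≈ g x) xs → sumMap f xs ≈ sumMap g xs
  sumMap-cong []           = refl
  sumMap-cong (fx≈gx ∷ eq) = +-cong fx≈gx (sumMap-cong eq)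

  sumMap-++ : ∀ {A : Set} (f : A → Carrier) xs ys → sumMap f (xs ++ ys) ≈ sumMap f xs + sumMap f ys
  sumMap-++ f []       ys = sym (+-identityˡ _)
  sumMap-++ f (x ∷ xs) ys = trans (+-congˡ (sumMap-++ f xs ys)) (sym (+-assoc _ _ _))

  sumMap-concatMap : ∀ {A B : Set} (f : B → Carrier) (g : A → List B) xs →
    sumMap f (concatMap g xs) ≈ sumMap (sumMap f ∘ g) xs
  sumMap-concatMap f g []       = refl
  sumMap-concatMap f g (x ∷ xs) = trans (sumMap-++ f (g x) (concatMap g xs)) (+-congˡ (sumMap-concatMap f g xs))

  sumMap-+ : ∀ {A : Set} (f g : A → Carrier) xs → sumMap (λ x → f x + g x) xs ≈ sumMap f xs + sumMap g xs
  sumMap-+ f g []       = sym (+-identityˡ 0#)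
  sumMap-+ f g (x ∷ xs) = trans (+-congˡ (sumMap-+ f g xs)) (interchange _ _ _ _)

  sumMap-*ˡ : ∀ {A : Set} a (f : A → Carrier) xs → sumMap (λ x → a * f x) xs ≈ a * sumMap f xs
  sumMap-*ˡ a f []       = sym (zeroʳ a)
  sumMap-*ˡ a f (x ∷ xs) = trans (+-congˡ (sumMap-*ˡ a f xs)) (sym (distribˡ a _ _))

  sumMap-filterᵇ : ∀ {A : Set} (f : A → Carrier) (p : A → Bool) xs →
    sumMap f (filterᵇ p xs) ≈ sumMap (λ x → if p x then f x else 0#) xs
  sumMap-filterᵇ f p []       = refl
  sumMap-filterᵇ f p (x ∷ xs) with p x
  ... | true  = +-congˡ (sumMap-filterᵇ f p xs)
  ... | false = trans (sumMap-filterᵇ f p xs) (sym (+-identityˡ _))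

  pow-+ : ∀ x m n → pow x (m +ℕ n) ≈ pow x m * pow x n
  pow-+ x zero    n = sym (*-identityˡ _)
  pow-+ x (suc m) n = trans (*-congˡ (pow-+ x m n)) (sym (*-assoc _ _ _))

  qnat-suc : ∀ q m → qnat q (suc m) ≈ qnat q m + pow q m
  qnat-suc q zero    = solve 1 (λ q → con 1 :+ q :* con 0 := con 0 :+ con 1) refl q
  qnat-suc q (suc m) = trans (+-congˡ (*-congˡ (qnat-suc q m)))
    (solve 3 (λ q a b → con 1 :+ q :* (a :+ b) := (con 1 :+ q :* a) :+ q :* b) refl q (qnat q m) (pow q m))

  -- The generating function of inner insertions

  module Insertion (q : Carrier) where

    desMajWeight : (ℕ → Carrier) → List ℕ → Carrier
    desMajWeight f w = f (desL w) * pow q (majL w)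

    twist : Bool → (ℕ → Carrier) → ℕ → Carrier
    twist c f x = f (𝟙 c +ℕ x) * pow q (𝟙 c +ℕ x)

    desMajWeight-∷ : ∀ f a w {c} → startsBelow a w ≡ c →
      desMajWeight f (a ∷ w) ≡ f (𝟙 c +ℕ desL w) * pow q (𝟙 c +ℕ (majL w +ℕ desL w))
    desMajWeight-∷ f a w ≡.refl = ≡.cong₂ (λ d m → f d * pow q m) (desL-∷ a w) (majL-∷ a w)

    desMajWeight-∷-twist : ∀ f a w {c} → startsBelow a w ≡ c → desMajWeight f (a ∷ w) ≈ desMajWeight (twist c f) w
    desMajWeight-∷-twist f a w {c} eq = begin
      desMajWeight f (a ∷ w)                                     ≡⟨ desMajWeight-∷ f a w eq ⟩
      f (e +ℕ desL w) * pow q (e +ℕ (majL w +ℕ desL w))          ≡⟨ ≡.cong (λ m → f (e +ℕ desL w) * pow q m) exponent ⟩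
      f (e +ℕ desL w) * pow q ((e +ℕ desL w) +ℕ majL w)          ≈⟨ *-congˡ (pow-+ q (e +ℕ desL w) (majL w)) ⟩
      f (e +ℕ desL w) * (pow q (e +ℕ desL w) * pow q (majL w))   ≈⟨ *-assoc _ _ _ ⟨
      desMajWeight (twist c f) w                                 ∎
      where
      e = 𝟙 c
      exponent : e +ℕ (majL w +ℕ desL w) ≡ (e +ℕ desL w) +ℕ majL w
      exponent = ≡.trans (≡.cong (e +ℕ_) (ℕₚ.+-comm (majL w) (desL w))) (≡.sym (ℕₚ.+-assoc e (desL w) (majL w)))

    insertionGF : (ℕ → Carrier) → (d m L : ℕ) → Carrier
    insertionGF f d m L = pow q m * (f d * (q * qnat q d) + f (suc d) * (pow q (suc d) * qnat q (L ∸ d)))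

    -- The weight of the one inner insertion of n into a ∷ b ∷ r that the induction hypothesis for b ∷ r
    -- does not cover: n ∷ a ∷ b ∷ r if a < b, and a ∷ n ∷ b ∷ r if b < a.
    extraTerm : Bool → (ℕ → Carrier) → ℕ → ℕ → Carrier
    extraTerm c f D M = f (suc D) * pow q (suc D) * pow q (𝟙 c +ℕ (M +ℕ D))

    insertionGF-step : ∀ c f D M L → D ≤ L →
      extraTerm c f D M + insertionGF (twist c f) D M L ≈ insertionGF f (𝟙 c +ℕ D) (𝟙 c +ℕ (M +ℕ D)) (suc L)
    insertionGF-step false f D M L D≤L = begin
      f₁ * (q * P) * pow q (M +ℕ D) + Q * ((f₀ * P) * (q * g) + (f₁ * (q * P)) * ((q * P) * h))
        ≈⟨ +-congʳ (*-congˡ (pow-+ q M D)) ⟩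
      f₁ * (q * P) * (Q * P) + Q * ((f₀ * P) * (q * g) + (f₁ * (q * P)) * ((q * P) * h))
        ≈⟨ solve 7 (λ q Q P f₀ f₁ g h →
             f₁ :* (q :* P) :* (Q :* P) :+ Q :* ((f₀ :* P) :* (q :* g) :+ (f₁ :* (q :* P)) :* ((q :* P) :* h))
             := (Q :* P) :* (f₀ :* (q :* g) :+ f₁ :* ((q :* P) :* (con 1 :+ q :* h)))) refl q Q P f₀ f₁ g h ⟩
      (Q * P) * (f₀ * (q * g) + f₁ * ((q * P) * qnat q (suc (L ∸ D))))
        ≈⟨ *-cong (sym (pow-+ q M D)) (+-congˡ (*-congˡ (*-congˡ (reflexive length-step)))) ⟩
      insertionGF f D (M +ℕ D) (suc L) ∎
      where
      Q = pow q M
      P = pow q D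
      g = qnat q D
      h = qnat q (L ∸ D)
      f₀ = f D
      f₁ = f (suc D)
      length-step : qnat q (suc (L ∸ D)) ≡ qnat q (suc L ∸ D)
      length-step = ≡.cong (qnat q) (≡.sym (ℕₚ.+-∸-assoc 1 D≤L))
    insertionGF-step true f D M L _ = begin
      f₁ * (q * P) * (q * pow q (M +ℕ D)) + Q * ((f₁ * (q * P)) * (q * g) + (f₂ * (q * (q * P))) * ((q * P) * h))
        ≈⟨ +-congʳ (*-congˡ (*-congˡ (pow-+ q M D))) ⟩
      f₁ * (q * P) * (q * (Q * P)) + Q * ((f₁ * (q * P)) * (q * g) + (f₂ * (q * (q * P))) * ((q * P) * h))
        ≈⟨ solve 7 (λ q Q P f₁ f₂ g h →
             f₁ :* (q :* P) :* (q :* (Q :* P))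
               :+ Q :* ((f₁ :* (q :* P)) :* (q :* g) :+ (f₂ :* (q :* (q :* P))) :* ((q :* P) :* h))
             := (q :* (Q :* P)) :* (f₁ :* (q :* (g :+ P)) :+ f₂ :* ((q :* (q :* P)) :* h))) refl q Q P f₁ f₂ g h ⟩
      (q * (Q * P)) * (f₁ * (q * (g + P)) + f₂ * ((q * (q * P)) * h))
        ≈⟨ *-cong (*-congˡ (sym (pow-+ q M D))) (+-congʳ (*-congˡ (*-congˡ (sym (qnat-suc q D))))) ⟩
      insertionGF f (suc D) (suc (M +ℕ D)) (suc L) ∎
      where
      Q = pow q M
      P = pow q D
      g = qnat q D
      h = qnat q (L ∸ D)
      f₁ = f (suc D)
      f₂ = f (suc (suc D))

    innerInsertions-∷∷ : ∀ n a b r f → a < n → b < n →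
      sumMap (desMajWeight f) (innerInsertions n (a ∷ b ∷ r))
        ≈ extraTerm (b <ᵇ a) f (desL (b ∷ r)) (majL (b ∷ r))
          + sumMap (desMajWeight (twist (b <ᵇ a) f)) (innerInsertions n (b ∷ r))
    innerInsertions-∷∷ n a b r f a<n b<n = byFrontDescent (b <ᵇ a) ≡.refl
      where
      F = desMajWeight
      v = b ∷ r
      D = desL v
      M = majL v
      I = innerInsertions n r

      n-above-a : startsBelow n (a ∷ v) ≡ true
      n-above-a = to T-≡ (<⇒<ᵇ a<n)
      a-below-n : startsBelow a (n ∷ v) ≡ false
      a-below-n = <ᵇ-false (<⇒≤ a<n)
      n-above-b : startsBelow n v ≡ true
      n-above-b = to T-≡ (<⇒<ᵇ b<n)

      head-terms : ∀ {c} → (b <ᵇ a) ≡ c →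
        sumMap (F f) (innerInsertions n (a ∷ v))
          ≈ F (twist true f) (a ∷ v) + (F (twist false f) (n ∷ v) + sumMap (F (twist c f)) (map (b ∷_) I))
      head-terms {c} front =
        +-cong (desMajWeight-∷-twist f n (a ∷ v) n-above-a)
               (+-cong (desMajWeight-∷-twist f a (n ∷ v) a-below-n) (begin
                  sumMap (F f) (map (a ∷_) (map (b ∷_) I))  ≡⟨ sumMap-map (F f) (a ∷_) (map (b ∷_) I) ⟩
                  sumMap (F f ∘ (a ∷_)) (map (b ∷_) I)      ≡⟨ sumMap-map (F f ∘ (a ∷_)) (b ∷_) I ⟩
                  sumMap (F f ∘ (a ∷_) ∘ (b ∷_)) I          ≈⟨ sumMap-cong (All.universal prepend-a I) ⟩
                  sumMap (F (twist c f) ∘ (b ∷_)) I         ≡⟨ sumMap-map (F (twist c f)) (b ∷_) I ⟨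
                  sumMap (F (twist c f)) (map (b ∷_) I)     ∎))
        where
        prepend-a : ∀ x → F f (a ∷ b ∷ x) ≈ F (twist c f) (b ∷ x)
        prepend-a x = desMajWeight-∷-twist f a (b ∷ x) front

      byFrontDescent : ∀ c → (b <ᵇ a) ≡ c →
        sumMap (F f) (innerInsertions n (a ∷ v)) ≈ extraTerm c f D M + sumMap (F (twist c f)) (innerInsertions n v)
      byFrontDescent false front = begin
        sumMap (F f) (innerInsertions n (a ∷ v))
          ≈⟨ head-terms front ⟩
        F (twist true f) (a ∷ v) + sumMap (F (twist false f)) (innerInsertions n v)
          ≡⟨ ≡.cong (_+ sumMap (F (twist false f)) (innerInsertions n v)) (desMajWeight-∷ (twist true f) a v front) ⟩
        extraTerm false f D M + sumMap (F (twist false f)) (innerInsertions n v) ∎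
      byFrontDescent true front = begin
        sumMap (F f) (innerInsertions n (a ∷ v))
          ≈⟨ head-terms front ⟩
        F (twist true f) (a ∷ v) + (F (twist false f) (n ∷ v) + rest)
          ≡⟨ ≡.cong₂ (λ x y → x + (y + rest))
               (≡.trans (desMajWeight-∷ (twist true f) a v front) (≡.sym (desMajWeight-∷ (twist true f) n v n-above-b)))
               (desMajWeight-∷ (twist false f) n v n-above-b) ⟩
        F (twist true f) (n ∷ v) + (extraTerm true f D M + rest)
          ≈⟨ x∙yz≈y∙xz _ _ _ ⟩
        extraTerm true f D M + sumMap (F (twist true f)) (innerInsertions n v) ∎
        where rest = sumMap (F (twist true f)) (map (b ∷_) I)

    -- f is generalised because prepending a letter is absorbed into it by twist.
    innerInsertions-desMaj : ∀ n v f → T (allBelow n v) →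
      sumMap (desMajWeight f) (innerInsertions n v) ≈ insertionGF f (desL v) (majL v) (length v)
    innerInsertions-desMaj n []          f _ =
      solve 3 (λ q f₀ f₁ → con 0 := con 1 :* (f₀ :* (q :* con 0) :+ f₁ :* ((q :* con 1) :* con 0))) refl q (f 0) (f 1)
    innerInsertions-desMaj n (a ∷ [])    f h = begin
      desMajWeight f (n ∷ a ∷ []) + 0#
        ≡⟨ ≡.cong (_+ 0#) (desMajWeight-∷ f n [ a ] (to T-≡ (<⇒<ᵇ (proj₁ (allBelow-∷ n a [] h))))) ⟩
      f 1 * (q * 1#) + 0#
        ≈⟨ solve 3 (λ q f₀ f₁ → f₁ :* (q :* con 1) :+ con 0
                              := con 1 :* (f₀ :* (q :* con 0) :+ f₁ :* ((q :* con 1) :* (con 1 :+ q :* con 0))))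
                   refl q (f 0) (f 1) ⟩
      insertionGF f 0 0 1 ∎
    innerInsertions-desMaj n (a ∷ b ∷ r) f h = begin
      sumMap (desMajWeight f) (innerInsertions n (a ∷ b ∷ r))
        ≈⟨ innerInsertions-∷∷ n a b r f a<n (proj₁ (allBelow-∷ n b r h′)) ⟩
      extraTerm front f D M + sumMap (desMajWeight (twist front f)) (innerInsertions n (b ∷ r))
        ≈⟨ +-congˡ (innerInsertions-desMaj n (b ∷ r) (twist front f) h′) ⟩
      extraTerm front f D M + insertionGF (twist front f) D M L
        ≈⟨ insertionGF-step front f D M L (desL≤length (b ∷ r)) ⟩
      insertionGF f (𝟙 front +ℕ D) (𝟙 front +ℕ (M +ℕ D)) (suc L)
        ≡⟨ ≡.cong₂ (λ d m → insertionGF f d m (suc L)) (desL-∷ a (b ∷ r)) (majL-∷ a (b ∷ r)) ⟨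
      insertionGF f (desL (a ∷ b ∷ r)) (majL (a ∷ b ∷ r)) (length (a ∷ b ∷ r)) ∎
      where
      front = b <ᵇ a
      a<n = proj₁ (allBelow-∷ n a (b ∷ r) h)
      h′ = proj₂ (allBelow-∷ n a (b ∷ r) h)
      D = desL (b ∷ r)
      M = majL (b ∷ r)
      L = length (b ∷ r)

  -- The recurrence

  module Bracket (q qinv t u : Carrier) where
    open Insertion q

    statWeight : ℕ → ℕ → ℕ × ℕ × ℕ → Carrier
    statWeight n k (s , e , m) = if suc e ≡ᵇ k then pow u s * (pow (t * qinv) (n ∸ s) * pow q m) else 0#

    wordWeight : ℕ → ℕ → List ℕ → Carrier
    wordWeight n k w = statWeight n k (wordStats w)

    eulerianBracket-permsByInsertion : ∀ S E M → StirlingEulerMahonian S E M → ∀ n k →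
      eulerianBracket S E M q qinv t u n k ≈ sumMap (wordWeight n k) (permsByInsertion n)
    eulerianBracket-permsByInsertion S E M sem n k = begin
      eulerianBracket S E M q qinv t u n k
        ≈⟨ sumMap-filterᵇ _ (λ σ → suc (E n σ) ≡ᵇ k) (Perms n) ⟩
      sumMap (statWeight n k ∘ stats S E M n) (Perms n)
        ≡⟨ sumMap-map (statWeight n k) (stats S E M n) (Perms n) ⟨
      sumMap (statWeight n k) (map (stats S E M n) (Perms n))
        ≈⟨ sumMap-↭ (statWeight n k) (stats↭wordStats S E M sem n) ⟩
      sumMap (statWeight n k) (map wordStats (permsByInsertion n))
        ≡⟨ sumMap-map (statWeight n k) wordStats (permsByInsertion n) ⟩
      sumMap (wordWeight n k) (permsByInsertion n) ∎

    module _ (q*qinv≈1 : q * qinv ≈ 1#) (n k : ℕ) where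
      tq = t * qinv
      C = (t * pow q k * qinv) * qint q qinv (suc n ⊖ k)

      desCoefficient : ℕ → ℕ → Carrier
      desCoefficient r x = if x ≡ᵇ k then pow u r * pow tq (suc n ∸ r) else 0#

      baseWeight : ℕ → ℕ → Carrier
      baseWeight r m = pow u r * (pow tq (n ∸ r) * pow q m)

      pow-tq-suc : ∀ r → r ≤ n → pow tq (suc n ∸ r) ≡ tq * pow tq (n ∸ r)
      pow-tq-suc r r≤n = ≡.cong (pow tq) (ℕₚ.+-∸-assoc 1 r≤n)

      insertion-coefficients : ∀ r m d → r ≤ n → d ≤ n →
        insertionGF (desCoefficient r) d m n + ((if d ≡ᵇ k then u * baseWeight r m else 0#) + 0#)
          ≈ qshift q t u k * (if d ≡ᵇ k then baseWeight r m else 0#)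
            + C * (if suc d ≡ᵇ k then baseWeight r m else 0#)
      insertion-coefficients r m d r≤n d≤n with d ℕ.≟ k | suc d ℕ.≟ k
      ... | yes ≡.refl | _
        rewrite to T-≡ (≡⇒≡ᵇ d d ≡.refl) | ≡ᵇ-false {suc d} {d} (ℕₚ.<⇒≢ (ℕₚ.n<1+n d) ∘ ≡.sym) | pow-tq-suc r r≤n
        = begin
        pow q m * (pow u r * (tq * Tᵣ) * (q * g) + 0# * Z) + (u * (pow u r * (Tᵣ * pow q m)) + 0#)
          ≈⟨ solve 10 (λ Q ur T g t qinv q u Z C →
               Q :* (ur :* ((t :* qinv) :* T) :* (q :* g) :+ con 0 :* Z) :+ (u :* (ur :* (T :* Q)) :+ con 0)
               := (u :+ t :* ((q :* qinv) :* g)) :* (ur :* (T :* Q)) :+ C :* con 0) refl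
               (pow q m) (pow u r) Tᵣ g t qinv q u Z C ⟩
        (u + t * ((q * qinv) * g)) * baseWeight r m + C * 0#
          ≈⟨ +-congʳ (*-congʳ (+-congˡ (*-congˡ (trans (*-congʳ q*qinv≈1) (*-identityˡ g))))) ⟩
        qshift q t u d * baseWeight r m + C * 0# ∎
        where
        Tᵣ = pow tq (n ∸ r)
        g = qnat q d
        Z = pow q (suc d) * qnat q (n ∸ d)
      ... | no d≢k | yes ≡.refl
        rewrite ≡ᵇ-false d≢k | to T-≡ (≡⇒≡ᵇ d d ≡.refl) | pow-tq-suc r r≤n | ⊖-≥ (s≤s d≤n)
        = begin
        pow q m * (0# * (q * qnat q d) + pow u r * (tq * Tᵣ) * ((q * P) * h)) + (0# + 0#)
          ≈⟨ solve 10 (λ Q ur T P h g t qinv q X →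
               Q :* (con 0 :* (q :* g) :+ ur :* ((t :* qinv) :* T) :* ((q :* P) :* h)) :+ (con 0 :+ con 0)
               := X :* con 0 :+ ((t :* (q :* P) :* qinv) :* h) :* (ur :* (T :* Q))) refl
               (pow q m) (pow u r) Tᵣ P h (qnat q d) t qinv q (qshift q t u (suc d)) ⟩
        qshift q t u (suc d) * 0# + ((t * pow q (suc d) * qinv) * qnat q (n ∸ d)) * baseWeight r m ∎
        where
        Tᵣ = pow tq (n ∸ r)
        P = pow q d
        h = qnat q (n ∸ d)
      ... | no d≢k | no 1+d≢k rewrite ≡ᵇ-false d≢k | ≡ᵇ-false 1+d≢k =
        solve 5 (λ Q A B X C → Q :* (con 0 :* A :+ con 0 :* B) :+ (con 0 :+ con 0) := X :* con 0 :+ C :* con 0) refl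
          (pow q m) (q * qnat q d) (pow q (suc d) * qnat q (n ∸ d)) (qshift q t u k) C

      insertions-wordWeight : ∀ v → T (isPerm n v) →
        sumMap (wordWeight (suc n) (suc k)) (insertions n v)
          ≈ qshift q t u k * wordWeight n (suc k) v + C * wordWeight n k v
      insertions-wordWeight v v-perm = begin
        sumMap W (insertions n v)
          ≡⟨ ≡.cong (sumMap W) (insertions-split n v) ⟩
        sumMap W (innerInsertions n v ++ [ v ++ [ n ] ])
          ≈⟨ sumMap-++ W (innerInsertions n v) [ v ++ [ n ] ] ⟩
        sumMap W (innerInsertions n v) + (W (v ++ [ n ]) + 0#)
          ≈⟨ +-cong inner (+-congʳ last) ⟩
        insertionGF (desCoefficient r) d m n + ((if d ≡ᵇ k then u * baseWeight r m else 0#) + 0#)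
          ≈⟨ insertion-coefficients r m d (≡.subst (r ≤_) len (rlminL≤length v)) (≡.subst (d ≤_) len (desL≤length v)) ⟩
        qshift q t u k * wordWeight n (suc k) v + C * wordWeight n k v ∎
        where
        W = wordWeight (suc n) (suc k)
        r = rlminL v
        d = desL v
        m = majL v
        len : length v ≡ n
        len = proj₁ (proj₂ (isPerm⇒ n v v-perm))
        below : T (allBelow n v)
        below = proj₂ (proj₂ (isPerm⇒ n v v-perm))

        factor : ∀ w → rlminL w ≡ r → W w ≈ desMajWeight (desCoefficient r) w
        factor w rw≡r rewrite rw≡r with desL w ≡ᵇ k
        ... | true  = sym (*-assoc _ _ _)
        ... | false = sym (zeroˡ _)

        inner : sumMap W (innerInsertions n v) ≈ insertionGF (desCoefficient r) d m n
        inner = begin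
          sumMap W (innerInsertions n v)
            ≈⟨ sumMap-cong (All.map (λ {w} → factor w) (rlminL-innerInsertions n v below)) ⟩
          sumMap (desMajWeight (desCoefficient r)) (innerInsertions n v)
            ≈⟨ innerInsertions-desMaj n v (desCoefficient r) below ⟩
          insertionGF (desCoefficient r) d m (length v)
            ≡⟨ ≡.cong (insertionGF (desCoefficient r) d m) len ⟩
          insertionGF (desCoefficient r) d m n ∎

        last : W (v ++ [ n ]) ≈ (if d ≡ᵇ k then u * baseWeight r m else 0#)
        last rewrite desL-++-max n v below | rlminL-++-max n v below | majL-++-max n v below with d ≡ᵇ k
        ... | true  = *-assoc _ _ _
        ... | false = refl

      eulerianBracket-recurrence : ∀ S E M → StirlingEulerMahonian S E M →
        eulerianBracket S E M q qinv t u (suc n) (suc k)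
          ≈ qshift q t u k * eulerianBracket S E M q qinv t u n (suc k)
            + (t * pow q k * qinv) * qint q qinv (suc n ⊖ k) * eulerianBracket S E M q qinv t u n k
      eulerianBracket-recurrence S E M sem = begin
        eulerianBracket S E M q qinv t u (suc n) (suc k)
          ≈⟨ eulerianBracket-permsByInsertion S E M sem (suc n) (suc k) ⟩
        sumMap (wordWeight (suc n) (suc k)) (concatMap (insertions n) Pₙ)
          ≈⟨ sumMap-concatMap (wordWeight (suc n) (suc k)) (insertions n) Pₙ ⟩
        sumMap (λ v → sumMap (wordWeight (suc n) (suc k)) (insertions n v)) Pₙ
          ≈⟨ sumMap-cong (tabulate (λ {v} v∈ → insertions-wordWeight v (isPerm-member n v∈))) ⟩
        sumMap (λ v → A * wordWeight n (suc k) v + C * wordWeight n k v) Pₙ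
          ≈⟨ sumMap-+ (λ v → A * wordWeight n (suc k) v) (λ v → C * wordWeight n k v) Pₙ ⟩
        sumMap (λ v → A * wordWeight n (suc k) v) Pₙ + sumMap (λ v → C * wordWeight n k v) Pₙ
          ≈⟨ +-cong (sumMap-*ˡ A (wordWeight n (suc k)) Pₙ) (sumMap-*ˡ C (wordWeight n k) Pₙ) ⟩
        A * sumMap (wordWeight n (suc k)) Pₙ + C * sumMap (wordWeight n k) Pₙ
          ≈⟨ +-cong (*-congˡ (eulerianBracket-permsByInsertion S E M sem n (suc k)))
                    (*-congˡ (eulerianBracket-permsByInsertion S E M sem n k)) ⟨
        A * eulerianBracket S E M q qinv t u n (suc k) + C * eulerianBracket S E M q qinv t u n k ∎
        where
        A = qshift q t u k
        Pₙ = permsByInsertion n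

mainTheorem15 : ∀ {c ℓ} (R : CommutativeRing c ℓ) →
    let open CommutativeRing R
        open QAnalogues R
    in (S E M : Statistic) → StirlingEulerMahonian S E M →
       (q qinv t u : Carrier) → q * qinv ≈ 1# →
       (1# - q) * u ≈ 1# - t →
       (n k : ℕ) → 1 ≤ n → 1 ≤ k →
       eulerianBracket S E M q qinv t u n k
         ≈ qshift q t u (k ∸ 1) * eulerianBracket S E M q qinv t u (n ∸ 1) k
           + (t * pow q (k ∸ 1) * qinv) * qint q qinv (n ⊖ (k ∸ 1))
             * eulerianBracket S E M q qinv t u (n ∸ 1) (k ∸ 1)
mainTheorem15 R S E M sem q qinv t u q*qinv≈1 _ (suc n) (suc k) (s≤s z≤n) (s≤s z≤n) =
  Bracket.eulerianBracket-recurrence R q qinv t u q*qinv≈1 n k S E M sem
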